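{- For the hard-core model at activity $\lambda=3.3$, WSM holds for the tree $T_{\boldsymbol{D}_G}$.
   Context: Hard-core model on a finite graph at activity $\lambda>0$: distribution on independent sets $I$ with $\mu(I)\propto\lambda^{|I|}$; $p_v(\tau)$ is the probability that $v$ is unoccupied conditioned on a configuration $\tau$ on a set of vertices. For an infinite locally finite rooted tree $T$ with root $r$, $T_L$ is the subtree induced by vertices at depth $\le L$; WSM holds for $T$ at $\lambda$ if there is $\gamma\in(0,1)$ such that for all $L$ and all configurations $\tau_1,\tau_2$ on the depth-$L$ vertices of $T_L$, $|p_r(\tau_1)-p_r(\tau_2)|\le\gamma^L$ (computed in $T_L$). $T_{\boldsymbol{D}_G}$ is the rooted tree of walks in $\mathbb{Z}^2$ from the origin with steps $N=(0,1),E=(1,0),W=(-1,0)$ generated by the rules (the last letter of a state is the step just taken; each listed state gives one child): $O\to N|E|W$ (root), $N\to NN|NE|NW$, $W\to WN|WW$, $E\to EN|EE$, $NN\to NN|NE|NW$, $NW\to WN|WW$, $NE\to EN|EE$, $WW\to WN|WW$, $EE\to EN|EE$, $WN\to NW|NN$, $EN\to NE|NN$. -}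

module Defs where

open import Data.Bool using (Bool; true; false; _∧_; _∨_; not; if_then_else_)
open import Data.Nat using (ℕ; zero; suc)
open import Data.List using (List; []; _∷_; map; concatMap; filter)
open import Data.Integer using (+_)
open import Data.Rational using (ℚ; 0ℚ; 1ℚ; _+_; _*_; _-_; _÷_; ∣_∣; _≤_; _<_; _/_; ≢-nonZero)
open import Data.Rational.Properties using (_≟_)
open import Data.Product using (Σ; _×_; _,_)
open import Relation.Nullary using (yes; no)

data State : Set where
  O N E W NN NW NE WW EE WN EN : State

children : State → List State
children O  = N ∷ E ∷ W ∷ []
children N  = NN ∷ NE ∷ NW ∷ []
children W  = WN ∷ WW ∷ []
children E  = EN ∷ EE ∷ []
children NN = NN ∷ NE ∷ NW ∷ []
children NW = WN ∷ WW ∷ []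
children NE = EN ∷ EE ∷ []
children WW = WN ∷ WW ∷ []
children EE = EN ∷ EE ∷ []
children WN = NW ∷ NN ∷ []
children EN = NE ∷ NN ∷ []

data Tree : Set where
  node : List Tree → Tree

build : ℕ → State → Tree
build zero    s = node []
build (suc L) s = node (map (build L) (children s))

TDG : ℕ → Tree
TDG L = build L O

-- Configurations (occupied = true) on all vertices of a finite tree.

data Conf : Tree → Set
data Confs : List Tree → Set

data Conf where
  _◂_ : ∀ {ts} → Bool → Confs ts → Conf (node ts)

data Confs where
  []  : Confs []
  _∷_ : ∀ {t ts} → Conf t → Confs ts → Confs (t ∷ ts)

occ : ∀ {t} → Conf t → Bool
occ (b ◂ _) = b

anyOcc : ∀ {ts} → Confs ts → Bool
anyOcc [] = false
anyOcc (c ∷ cs) = occ c ∨ anyOcc cs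

indep  : ∀ {t} → Conf t → Bool
indeps : ∀ {ts} → Confs ts → Bool
indep (b ◂ cs) = not (b ∧ anyOcc cs) ∧ indeps cs
indeps [] = true
indeps (c ∷ cs) = indep c ∧ indeps cs

size  : ∀ {t} → Conf t → ℕ
sizes : ∀ {ts} → Confs ts → ℕ
size (b ◂ cs) = (if b then 1 else 0) Data.Nat.+ sizes cs
sizes [] = 0
sizes (c ∷ cs) = size c Data.Nat.+ sizes cs

allConf  : (t : Tree) → List (Conf t)
allConfs : (ts : List Tree) → List (Confs ts)
allConf (node ts) = concatMap (λ b → map (b ◂_) (allConfs ts)) (true ∷ false ∷ [])
allConfs [] = [] ∷ []
allConfs (t ∷ ts) = concatMap (λ c → map (c ∷_) (allConfs ts)) (allConf t)

-- Configurations on the leaves of a finite tree.  In T_L every leaf is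
-- at depth exactly L and every depth-L vertex is a leaf, so these are
-- exactly the configurations on the depth-L vertices.

data Bd : Tree → Set
data Bds : List Tree → Set

data Bd where
  leaf  : Bool → Bd (node [])
  inner : ∀ {t ts} → Bds (t ∷ ts) → Bd (node (t ∷ ts))

data Bds where
  []  : Bds []
  _∷_ : ∀ {t ts} → Bd t → Bds ts → Bds (t ∷ ts)

agree  : ∀ {t} → Conf t → Bd t → Bool
agrees : ∀ {ts} → Confs ts → Bds ts → Bool
agree (b ◂ []) (leaf b') = (b ∧ b') ∨ (not b ∧ not b')
agree (b ◂ cs) (inner τs) = agrees cs τs
agrees [] [] = true
agrees (c ∷ cs) (τ ∷ τs) = agree c τ ∧ agrees cs τs

_^_ : ℚ → ℕ → ℚ
x ^ zero  = 1ℚ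
x ^ suc n = x * (x ^ n)

sumℚ : List ℚ → ℚ
sumℚ [] = 0ℚ
sumℚ (x ∷ xs) = x + sumℚ xs

-- total division (the denominators used below are always positive)
_⊘_ : ℚ → ℚ → ℚ
p ⊘ q with q ≟ 0ℚ
... | yes _  = 0ℚ
... | no q≢0 = _÷_ p q {{≢-nonZero q≢0}}

weightSum : ℚ → (t : Tree) → Bd t → (Conf t → Bool) → ℚ
weightSum lam t τ P =
  sumℚ (map (λ σ → if indep σ ∧ agree σ τ ∧ P σ then lam ^ size σ else 0ℚ) (allConf t))

pRoot : ℚ → (t : Tree) → Bd t → ℚ
pRoot lam t τ = weightSum lam t τ (λ σ → not (occ σ)) ⊘ weightSum lam t τ (λ _ → true)

-- weak spatial mixing for T_{D_G} at activity λ
-- (γ rational: equivalent to γ real, as a real γ<1 can be replaced by a larger rational)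
WSM-TDG : ℚ → Set
WSM-TDG lam = Σ ℚ (λ γ → (0ℚ < γ) × (γ < 1ℚ) ×
  ((L : ℕ) (τ₁ τ₂ : Bd (TDG L)) → ∣ pRoot lam (TDG L) τ₁ - pRoot lam (TDG L) τ₂ ∣ ≤ γ ^ L))

activity : ℚ
activity = + 33 / 10

-- By the tree recursion of the hard-core model, the probability p_v that a vertex v is
-- unoccupied, given a boundary condition on the leaves below it, is F(∏_c p_c) with
-- F(x) = 1/(1 + λx), the product running over the children of v.  Since F is antitone, bounds
-- lo_s ≤ p ≤ hi_s holding for all subtrees of type s and depth L give the bounds
-- F(∏ hi_c) ≤ p ≤ F(∏ lo_c) at depth L + 1.  Starting from [0, 1], K = 1200 rounds of this
-- interval recursion are carried out in exact fixed-point arithmetic, and a computation checks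
-- that every box encloses the next one and that the root interval at depth L ≤ K has width at
-- most γ^L, γ = 499/500.  The final box [lB, hB] is mapped into itself, and on it the recursion
-- contracts by γ in a weighted sup norm: F(a) − F(b) = λ F(a) F(b) (b − a) ≤ λ hB² (b − a), and
-- ∏ hi − ∏ lo ≤ Σᵢ (hiᵢ − loᵢ) ∏_{j≠i} hB_j.  Iterating this bounds the gap at every depth L > K.

module Submission where

open import Defs

open import Data.Bool using (Bool; true; false; _∧_; _∨_; not; if_then_else_; T)
open import Data.Bool.ListAction using (all)
open import Data.Bool.Properties using (T-∧; T-≡)
open import Data.Empty using (⊥-elim)
import Data.Integer as ℤ
import Data.Integer.Properties as ℤ
open import Data.Integer.Tactic.RingSolver using (solve-∀)
open import Data.List using (List; []; _∷_; map; concatMap; _++_; length)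
open import Data.List.Membership.Propositional using (_∈_)
open import Data.List.Relation.Unary.All using (lookup)
open import Data.List.Relation.Unary.All.Properties using (all⁺)
open import Data.List.Relation.Unary.Any using (here; there)
open import Data.Nat as ℕ using (ℕ; zero; suc)
open import Data.Nat.ListAction using (product)
import Data.Nat.Properties as ℕ
open import Data.Product using (_×_; _,_; proj₁; proj₂)
open import Data.Rational as ℚ using (ℚ; 0ℚ; 1ℚ; _+_; _*_; _-_; -_; _≤_; _<_; ∣_∣; _/_; 1/_)
open import Data.Rational.Literals using (fromℤ)
import Data.Rational.Properties as ℚ
open import Data.Rational.Solver using (module +-*-Solver)
import Data.Rational.Unnormalised.Base as ℚᵘ
import Data.Rational.Unnormalised.Properties as ℚᵘ
open import Data.Sum using (inj₁; inj₂)
open import Data.Unit using (tt)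
open import Function using (_∘_; Equivalence)
open import Relation.Binary.PropositionalEquality
open import Relation.Nullary using (yes; no)
open import Relation.Nullary.Decidable using (toWitness)

open +-*-Solver using (solve; _:+_; _:*_; _:-_; :-_; _:=_; con)
open Equivalence using (to; from)

private variable
  A B C : Set
  p q r s : ℚ

0≤1 : 0ℚ ≤ 1ℚ
0≤1 = ℚ.nonNegative⁻¹ 1ℚ

0<1 : 0ℚ < 1ℚ
0<1 = ℚ.positive⁻¹ 1ℚ

*-monoˡ-≤ : 0ℚ ≤ r → p ≤ q → r * p ≤ r * q
*-monoˡ-≤ {r} 0≤r = ℚ.*-monoˡ-≤-nonNeg r {{ℚ.nonNegative 0≤r}}

*-monoʳ-≤ : 0ℚ ≤ r → p ≤ q → p * r ≤ q * r
*-monoʳ-≤ {r} 0≤r = ℚ.*-monoʳ-≤-nonNeg r {{ℚ.nonNegative 0≤r}}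

*-mono-≤ : 0ℚ ≤ p → 0ℚ ≤ r → p ≤ q → r ≤ s → p * r ≤ q * s
*-mono-≤ 0≤p 0≤r p≤q r≤s = ℚ.≤-trans (*-monoʳ-≤ 0≤r p≤q) (*-monoˡ-≤ (ℚ.≤-trans 0≤p p≤q) r≤s)

*-cancelʳ-≤ : 0ℚ < r → p * r ≤ q * r → p ≤ q
*-cancelʳ-≤ {r} 0<r = ℚ.*-cancelʳ-≤-pos r {{ℚ.positive 0<r}}

0≤* : 0ℚ ≤ p → 0ℚ ≤ q → 0ℚ ≤ p * q
0≤* {p} {q} 0≤p 0≤q = ℚ.≤-trans (ℚ.≤-reflexive (sym (ℚ.*-zeroˡ q))) (*-monoʳ-≤ 0≤q 0≤p)

0<* : 0ℚ < p → 0ℚ < q → 0ℚ < p * q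
0<* {p} {q} 0<p 0<q = ℚ.positive⁻¹ (p * q) {{ℚ.pos*pos⇒pos p {{ℚ.positive 0<p}} q {{ℚ.positive 0<q}}}}

0≤+ : 0ℚ ≤ p → 0ℚ ≤ q → 0ℚ ≤ p + q
0≤+ = ℚ.+-mono-≤

0<+ : 0ℚ < p → 0ℚ ≤ q → 0ℚ < p + q
0<+ {p} 0<p 0≤q = ℚ.<-≤-trans 0<p (ℚ.≤-trans (ℚ.≤-reflexive (sym (ℚ.+-identityʳ p))) (ℚ.+-monoʳ-≤ p 0≤q))

0≤- : p ≤ q → 0ℚ ≤ q - p
0≤- {p} p≤q = ℚ.≤-trans (ℚ.≤-reflexive (sym (ℚ.+-inverseʳ p))) (ℚ.+-monoˡ-≤ (- p) p≤q)

∣-∣≤-width : ∀ {l h x y} → l ≤ x → x ≤ h → l ≤ y → y ≤ h → ∣ x - y ∣ ≤ h - l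
∣-∣≤-width {l} {h} {x} {y} l≤x x≤h l≤y y≤h with ℚ.∣p∣≡p∨∣p∣≡-p (x - y)
... | inj₁ ∣x-y∣≡x-y = ℚ.≤-trans (ℚ.≤-reflexive ∣x-y∣≡x-y) (ℚ.+-mono-≤ x≤h (ℚ.neg-antimono-≤ l≤y))
... | inj₂ ∣x-y∣≡y-x = ℚ.≤-trans (ℚ.≤-reflexive (trans ∣x-y∣≡y-x (solve 2 (λ x y → :- (x :- y) := y :- x) refl x y)))
                                 (ℚ.+-mono-≤ y≤h (ℚ.neg-antimono-≤ l≤x))

⊘*-cancel : ∀ p {q} → 0ℚ < q → (p ⊘ q) * q ≡ p
⊘*-cancel p {q} 0<q with q ℚ.≟ 0ℚ
... | yes q≡0 = ⊥-elim (ℚ.<-irrefl (sym q≡0) 0<q)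
... | no  q≢0 = begin
    p * 1/ q * q   ≡⟨ ℚ.*-assoc p (1/ q) q ⟩
    p * (1/ q * q) ≡⟨ cong (p *_) (ℚ.*-inverseˡ q) ⟩
    p * 1ℚ         ≡⟨ ℚ.*-identityʳ p ⟩
    p              ∎
  where
  open ≡-Reasoning
  instance _ = ℚ.≢-nonZero q≢0

⊘-unique : 0ℚ < q → r * q ≡ p → p ⊘ q ≡ r
⊘-unique {q} {r} {p} 0<q r*q≡p with q ℚ.≟ 0ℚ
... | yes q≡0 = ⊥-elim (ℚ.<-irrefl (sym q≡0) 0<q)
... | no  q≢0 = begin
    p * 1/ q       ≡⟨ cong (_* 1/ q) (sym r*q≡p) ⟩
    r * q * 1/ q   ≡⟨ ℚ.*-assoc r q (1/ q) ⟩
    r * (q * 1/ q) ≡⟨ cong (r *_) (ℚ.*-inverseʳ q) ⟩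
    r * 1ℚ         ≡⟨ ℚ.*-identityʳ r ⟩
    r              ∎
  where
  open ≡-Reasoning
  instance _ = ℚ.≢-nonZero q≢0

*≤⇒≤⊘ : 0ℚ < q → r * q ≤ p → r ≤ p ⊘ q
*≤⇒≤⊘ {q} {r} {p} 0<q r*q≤p = *-cancelʳ-≤ 0<q (ℚ.≤-trans r*q≤p (ℚ.≤-reflexive (sym (⊘*-cancel p 0<q))))

≤*⇒⊘≤ : 0ℚ < q → p ≤ r * q → p ⊘ q ≤ r
≤*⇒⊘≤ {q} {p} {r} 0<q p≤r*q = *-cancelʳ-≤ 0<q (ℚ.≤-trans (ℚ.≤-reflexive (⊘*-cancel p 0<q)) p≤r*q)

⊘-*-⊘ : ∀ p q r s → 0ℚ < q → 0ℚ < s → (p ⊘ q) * (r ⊘ s) ≡ (p * r) ⊘ (q * s)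
⊘-*-⊘ p q r s 0<q 0<s = sym (⊘-unique (0<* 0<q 0<s) (begin
    (p ⊘ q) * (r ⊘ s) * (q * s)
  ≡⟨ solve 4 (λ x y q s → x :* y :* (q :* s) := (x :* q) :* (y :* s)) refl (p ⊘ q) (r ⊘ s) q s ⟩
    ((p ⊘ q) * q) * ((r ⊘ s) * s)
  ≡⟨ cong₂ _*_ (⊘*-cancel p 0<q) (⊘*-cancel r 0<s) ⟩
    p * r ∎))
  where open ≡-Reasoning

^-+ : (x : ℚ) (m n : ℕ) → x ^ (m ℕ.+ n) ≡ x ^ m * x ^ n
^-+ x zero    n = sym (ℚ.*-identityˡ _)
^-+ x (suc m) n = trans (cong (x *_) (^-+ x m n)) (sym (ℚ.*-assoc x _ _))

^-nonNeg : 0ℚ ≤ p → ∀ n → 0ℚ ≤ p ^ n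
^-nonNeg 0≤p zero    = 0≤1
^-nonNeg 0≤p (suc n) = 0≤* 0≤p (^-nonNeg 0≤p n)

p≤q+r⇒p-q≤r : p ≤ q + r → p - q ≤ r
p≤q+r⇒p-q≤r {p} {q} {r} p≤q+r = ℚ.≤-trans (ℚ.+-monoˡ-≤ (- q) p≤q+r)
  (ℚ.≤-reflexive (solve 2 (λ q r → q :+ r :- q := r) refl q r))

∑ : (A → ℚ) → List A → ℚ
∑ f xs = sumℚ (map f xs)

∑-++ : (f : A → ℚ) (xs ys : List A) → ∑ f (xs ++ ys) ≡ ∑ f xs + ∑ f ys
∑-++ f [] ys = sym (ℚ.+-identityˡ _)
∑-++ f (x ∷ xs) ys = trans (cong (f x +_) (∑-++ f xs ys)) (sym (ℚ.+-assoc (f x) _ _))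

∑-map : (f : B → ℚ) (g : A → B) (xs : List A) → ∑ f (map g xs) ≡ ∑ (f ∘ g) xs
∑-map f g [] = refl
∑-map f g (x ∷ xs) = cong (f (g x) +_) (∑-map f g xs)

∑-cong : {f g : A → ℚ} → (∀ x → f x ≡ g x) → (xs : List A) → ∑ f xs ≡ ∑ g xs
∑-cong f≗g [] = refl
∑-cong f≗g (x ∷ xs) = cong₂ _+_ (f≗g x) (∑-cong f≗g xs)

∑-concatMap : (f : B → ℚ) (g : A → List B) (xs : List A) →
              ∑ f (concatMap g xs) ≡ ∑ (λ x → ∑ f (g x)) xs
∑-concatMap f g [] = refl
∑-concatMap f g (x ∷ xs) = trans (∑-++ f (g x) (concatMap g xs)) (cong (∑ f (g x) +_) (∑-concatMap f g xs))

∑-*ˡ : (k : ℚ) (f : A → ℚ) (xs : List A) → ∑ (λ x → k * f x) xs ≡ k * ∑ f xs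
∑-*ˡ k f [] = sym (ℚ.*-zeroʳ k)
∑-*ˡ k f (x ∷ xs) = trans (cong (k * f x +_) (∑-*ˡ k f xs)) (sym (ℚ.*-distribˡ-+ k (f x) (∑ f xs)))

∑-*ʳ : (k : ℚ) (f : A → ℚ) (xs : List A) → ∑ (λ x → f x * k) xs ≡ ∑ f xs * k
∑-*ʳ k f xs = trans (∑-cong (λ x → ℚ.*-comm (f x) k) xs) (trans (∑-*ˡ k f xs) (ℚ.*-comm k (∑ f xs)))

∑-product : (u : A → ℚ) (w : B → ℚ) (g : A → B → C) (h : C → ℚ) →
            (∀ a b → h (g a b) ≡ u a * w b) → (xs : List A) (ys : List B) →
            ∑ h (concatMap (λ a → map (g a) ys) xs) ≡ ∑ u xs * ∑ w ys
∑-product u w g h h≡uw xs ys = begin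
    ∑ h (concatMap (λ a → map (g a) ys) xs)
  ≡⟨ ∑-concatMap h (λ a → map (g a) ys) xs ⟩
    ∑ (λ a → ∑ h (map (g a) ys)) xs
  ≡⟨ ∑-cong (λ a → trans (∑-map h (g a) ys) (trans (∑-cong (h≡uw a) ys) (∑-*ˡ (u a) w ys))) xs ⟩
    ∑ (λ a → u a * ∑ w ys) xs
  ≡⟨ ∑-*ʳ (∑ w ys) u xs ⟩
    ∑ u xs * ∑ w ys ∎
  where open ≡-Reasoning

∏ : (A → ℚ) → List A → ℚ
∏ f []       = 1ℚ
∏ f (x ∷ xs) = f x * ∏ f xs

∏-nonNeg : (f : A → ℚ) → (∀ x → 0ℚ ≤ f x) → ∀ xs → 0ℚ ≤ ∏ f xs
∏-nonNeg f 0≤f []       = 0≤1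
∏-nonNeg f 0≤f (x ∷ xs) = 0≤* (0≤f x) (∏-nonNeg f 0≤f xs)

∏-mono-≤ : (f g : A → ℚ) → (∀ x → 0ℚ ≤ f x) → (∀ x → f x ≤ g x) → ∀ xs → ∏ f xs ≤ ∏ g xs
∏-mono-≤ f g 0≤f f≤g []       = ℚ.≤-refl
∏-mono-≤ f g 0≤f f≤g (x ∷ xs) = *-mono-≤ (0≤f x) (∏-nonNeg f 0≤f xs) (f≤g x) (∏-mono-≤ f g 0≤f f≤g xs)

-- ∂∏ M w xs = Σᵢ w xᵢ ∏_{j≠i} M xⱼ, the derivative of ∏ at M in the direction w.
∂∏ : (M w : A → ℚ) → List A → ℚ
∂∏ M w []       = 0ℚ
∂∏ M w (x ∷ xs) = w x * ∏ M xs + M x * ∂∏ M w xs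

∏-difference≤∂∏ : (lo hi M : A → ℚ) → (∀ x → 0ℚ ≤ lo x) → (∀ x → lo x ≤ hi x) → (∀ x → hi x ≤ M x) →
                  ∀ xs → ∏ hi xs - ∏ lo xs ≤ ∂∏ M (λ x → hi x - lo x) xs
∏-difference≤∂∏ lo hi M 0≤lo lo≤hi hi≤M [] = ℚ.≤-reflexive (ℚ.+-inverseʳ 1ℚ)
∏-difference≤∂∏ lo hi M 0≤lo lo≤hi hi≤M (x ∷ xs) = begin
    hi x * H - lo x * L
  ≡⟨ solve 4 (λ a b h l → a :* h :- b :* l := (a :- b) :* h :+ b :* (h :- l)) refl (hi x) (lo x) H L ⟩
    (hi x - lo x) * H + lo x * (H - L)
  ≤⟨ ℚ.+-mono-≤ (*-monoˡ-≤ (0≤- (lo≤hi x)) (∏-mono-≤ hi M 0≤hi hi≤M xs))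
                (*-mono-≤ (0≤lo x) (0≤- (∏-mono-≤ lo hi 0≤lo lo≤hi xs)) (ℚ.≤-trans (lo≤hi x) (hi≤M x))
                          (∏-difference≤∂∏ lo hi M 0≤lo lo≤hi hi≤M xs)) ⟩
    (hi x - lo x) * ∏ M xs + M x * ∂∏ M (λ x → hi x - lo x) xs ∎
  where
  open ℚ.≤-Reasoning
  H L : ℚ
  H = ∏ hi xs
  L = ∏ lo xs
  0≤hi : ∀ x → 0ℚ ≤ hi x
  0≤hi x = ℚ.≤-trans (0≤lo x) (lo≤hi x)

∂∏-mono-≤ : (M w w′ : A → ℚ) → (∀ x → 0ℚ ≤ M x) → (∀ x → w x ≤ w′ x) → ∀ xs → ∂∏ M w xs ≤ ∂∏ M w′ xs
∂∏-mono-≤ M w w′ 0≤M w≤w′ []       = ℚ.≤-refl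
∂∏-mono-≤ M w w′ 0≤M w≤w′ (x ∷ xs) =
  ℚ.+-mono-≤ (*-monoʳ-≤ (∏-nonNeg M 0≤M xs) (w≤w′ x)) (*-monoˡ-≤ (0≤M x) (∂∏-mono-≤ M w w′ 0≤M w≤w′ xs))

∂∏-*ˡ : (M w : A → ℚ) (k : ℚ) → ∀ xs → ∂∏ M (λ x → k * w x) xs ≡ k * ∂∏ M w xs
∂∏-*ˡ M w k []       = sym (ℚ.*-zeroʳ k)
∂∏-*ˡ M w k (x ∷ xs) = begin
    k * w x * ∏ M xs + M x * ∂∏ M (λ x → k * w x) xs
  ≡⟨ cong (λ d → k * w x * ∏ M xs + M x * d) (∂∏-*ˡ M w k xs) ⟩
    k * w x * ∏ M xs + M x * (k * ∂∏ M w xs)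
  ≡⟨ solve 5 (λ k a p m d → k :* a :* p :+ m :* (k :* d) := k :* (a :* p :+ m :* d)) refl k (w x) (∏ M xs) (M x) (∂∏ M w xs) ⟩
    k * (w x * ∏ M xs + M x * ∂∏ M w xs) ∎
  where open ≡-Reasoning

-- Partition functions of the hard-core model on a finite tree

⟪_⟫ : Bool → ℚ
⟪ b ⟫ = if b then 1ℚ else 0ℚ

⟪∧⟫ : ∀ a b → ⟪ a ∧ b ⟫ ≡ ⟪ a ⟫ * ⟪ b ⟫
⟪∧⟫ true  b = sym (ℚ.*-identityˡ ⟪ b ⟫)
⟪∧⟫ false b = sym (ℚ.*-zeroˡ ⟪ b ⟫)

⟪not-∨⟫ : ∀ a b → ⟪ not (a ∨ b) ⟫ ≡ ⟪ not a ⟫ * ⟪ not b ⟫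
⟪not-∨⟫ true  b = sym (ℚ.*-zeroˡ ⟪ not b ⟫)
⟪not-∨⟫ false b = sym (ℚ.*-identityˡ ⟪ not b ⟫)

if-∧-then-else-0 : ∀ a b c (x : ℚ) → (if a ∧ (b ∧ c) then x else 0ℚ) ≡ ⟪ c ⟫ * (⟪ a ∧ b ⟫ * x)
if-∧-then-else-0 true  true  true  x = sym (trans (ℚ.*-identityˡ _) (ℚ.*-identityˡ x))
if-∧-then-else-0 true  true  false x = sym (ℚ.*-zeroˡ (1ℚ * x))
if-∧-then-else-0 true  false c     x = sym (trans (cong (⟪ c ⟫ *_) (ℚ.*-zeroˡ x)) (ℚ.*-zeroʳ ⟪ c ⟫))
if-∧-then-else-0 false b     c     x = sym (trans (cong (⟪ c ⟫ *_) (ℚ.*-zeroˡ x)) (ℚ.*-zeroʳ ⟪ c ⟫))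

⟪∧⟫-interchange : ∀ a b c d → ⟪ (a ∧ b) ∧ (c ∧ d) ⟫ ≡ ⟪ a ∧ c ⟫ * ⟪ b ∧ d ⟫
⟪∧⟫-interchange a b c d = begin
    ⟪ (a ∧ b) ∧ (c ∧ d) ⟫
  ≡⟨ trans (⟪∧⟫ (a ∧ b) (c ∧ d)) (cong₂ _*_ (⟪∧⟫ a b) (⟪∧⟫ c d)) ⟩
    (⟪ a ⟫ * ⟪ b ⟫) * (⟪ c ⟫ * ⟪ d ⟫)
  ≡⟨ solve 4 (λ a b c d → (a :* b) :* (c :* d) := (a :* c) :* (b :* d)) refl ⟪ a ⟫ ⟪ b ⟫ ⟪ c ⟫ ⟪ d ⟫ ⟩
    (⟪ a ⟫ * ⟪ c ⟫) * (⟪ b ⟫ * ⟪ d ⟫)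
  ≡⟨ sym (cong₂ _*_ (⟪∧⟫ a c) (⟪∧⟫ b d)) ⟩
    ⟪ a ∧ c ⟫ * ⟪ b ∧ d ⟫ ∎
  where open ≡-Reasoning

∑-allConf-node : ∀ ts (f : Conf (node ts) → ℚ) →
  ∑ f (allConf (node ts)) ≡ ∑ (λ cs → f (true ◂ cs)) (allConfs ts) + ∑ (λ cs → f (false ◂ cs)) (allConfs ts)
∑-allConf-node ts f = begin
    ∑ f (allConf (node ts))
  ≡⟨ ∑-concatMap f (λ b → map (b ◂_) (allConfs ts)) (true ∷ false ∷ []) ⟩
    ∑ f (map (true ◂_) (allConfs ts)) + (∑ f (map (false ◂_) (allConfs ts)) + 0ℚ)
  ≡⟨ cong₂ (λ x y → x + (y + 0ℚ)) (∑-map f (true ◂_) (allConfs ts)) (∑-map f (false ◂_) (allConfs ts)) ⟩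
    ∑ (λ cs → f (true ◂ cs)) (allConfs ts) + (∑ (λ cs → f (false ◂ cs)) (allConfs ts) + 0ℚ)
  ≡⟨ cong (∑ (λ cs → f (true ◂ cs)) (allConfs ts) +_) (ℚ.+-identityʳ _) ⟩
    ∑ (λ cs → f (true ◂ cs)) (allConfs ts) + ∑ (λ cs → f (false ◂ cs)) (allConfs ts) ∎
  where open ≡-Reasoning

∑-allConfs-cong : ∀ {t ts} {f g : Confs (t ∷ ts) → ℚ} → (∀ c cs → f (c ∷ cs) ≡ g (c ∷ cs)) →
                  ∑ f (allConfs (t ∷ ts)) ≡ ∑ g (allConfs (t ∷ ts))
∑-allConfs-cong {t} {ts} {f} {g} f≗g = begin
    ∑ f (allConfs (t ∷ ts))
  ≡⟨ ∑-concatMap f (λ c → map (c ∷_) (allConfs ts)) (allConf t) ⟩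
    ∑ (λ c → ∑ f (map (c ∷_) (allConfs ts))) (allConf t)
  ≡⟨ ∑-cong (λ c → trans (∑-map f (c ∷_) (allConfs ts))
                    (trans (∑-cong (f≗g c) (allConfs ts)) (sym (∑-map g (c ∷_) (allConfs ts))))) (allConf t) ⟩
    ∑ (λ c → ∑ g (map (c ∷_) (allConfs ts))) (allConf t)
  ≡⟨ sym (∑-concatMap g (λ c → map (c ∷_) (allConfs ts)) (allConf t)) ⟩
    ∑ g (allConfs (t ∷ ts)) ∎
  where open ≡-Reasoning

module PartitionFunction (lam : ℚ) where

  weight : ∀ {t} → Bd t → Conf t → ℚ
  weight τ σ = ⟪ indep σ ∧ agree σ τ ⟫ * lam ^ size σ

  weights : ∀ {ts} → Bds ts → Confs ts → ℚ
  weights τs cs = ⟪ indeps cs ∧ agrees cs τs ⟫ * lam ^ sizes cs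

  freeWeight : ∀ {t} → Bd t → Conf t → ℚ
  freeWeight τ σ = ⟪ not (occ σ) ⟫ * weight τ σ

  freeWeights : ∀ {ts} → Bds ts → Confs ts → ℚ
  freeWeights τs cs = ⟪ not (anyOcc cs) ⟫ * weights τs cs

  -- Stated for a non-empty child configuration c ∷ cs: only then do indep and agree compute.
  weight-root-free : ∀ {t ts} (τs : Bds (t ∷ ts)) c cs →
                     weight (inner τs) (false ◂ (c ∷ cs)) ≡ weights τs (c ∷ cs)
  weight-root-free τs c cs = refl

  weight-root-occupied : ∀ {t ts} (τs : Bds (t ∷ ts)) c cs →
                         weight (inner τs) (true ◂ (c ∷ cs)) ≡ lam * freeWeights τs (c ∷ cs)
  weight-root-occupied τs c cs =
    factor (not (anyOcc (c ∷ cs))) (indeps (c ∷ cs)) (agrees (c ∷ cs) τs) (lam ^ sizes (c ∷ cs))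
    where
    factor : ∀ a b d x → ⟪ (a ∧ b) ∧ d ⟫ * (lam * x) ≡ lam * (⟪ a ⟫ * (⟪ b ∧ d ⟫ * x))
    factor true  b d x = solve 3 (λ y k x → y :* (k :* x) := k :* (con 1ℚ :* (y :* x))) refl ⟪ b ∧ d ⟫ lam x
    factor false b d x = solve 3 (λ y k x → con 0ℚ :* (k :* x) := k :* (con 0ℚ :* (y :* x))) refl ⟪ b ∧ d ⟫ lam x

  weights-∷ : ∀ {t ts} (τ : Bd t) (τs : Bds ts) c cs → weights (τ ∷ τs) (c ∷ cs) ≡ weight τ c * weights τs cs
  weights-∷ τ τs c cs = begin
      ⟪ (indep c ∧ indeps cs) ∧ (agree c τ ∧ agrees cs τs) ⟫ * lam ^ (size c ℕ.+ sizes cs)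
    ≡⟨ cong₂ _*_ (⟪∧⟫-interchange (indep c) (indeps cs) (agree c τ) (agrees cs τs)) (^-+ lam (size c) (sizes cs)) ⟩
      (⟪ indep c ∧ agree c τ ⟫ * ⟪ indeps cs ∧ agrees cs τs ⟫) * (lam ^ size c * lam ^ sizes cs)
    ≡⟨ solve 4 (λ a b x y → (a :* b) :* (x :* y) := (a :* x) :* (b :* y)) refl
         ⟪ indep c ∧ agree c τ ⟫ ⟪ indeps cs ∧ agrees cs τs ⟫ (lam ^ size c) (lam ^ sizes cs) ⟩
      weight τ c * weights τs cs ∎
    where open ≡-Reasoning

  freeWeights-∷ : ∀ {t ts} (τ : Bd t) (τs : Bds ts) c cs →
                  freeWeights (τ ∷ τs) (c ∷ cs) ≡ freeWeight τ c * freeWeights τs cs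
  freeWeights-∷ τ τs c cs = begin
      ⟪ not (occ c ∨ anyOcc cs) ⟫ * weights (τ ∷ τs) (c ∷ cs)
    ≡⟨ cong₂ _*_ (⟪not-∨⟫ (occ c) (anyOcc cs)) (weights-∷ τ τs c cs) ⟩
      (⟪ not (occ c) ⟫ * ⟪ not (anyOcc cs) ⟫) * (weight τ c * weights τs cs)
    ≡⟨ solve 4 (λ a b x y → (a :* b) :* (x :* y) := (a :* x) :* (b :* y)) refl
         ⟪ not (occ c) ⟫ ⟪ not (anyOcc cs) ⟫ (weight τ c) (weights τs cs) ⟩
      freeWeight τ c * freeWeights τs cs ∎
    where open ≡-Reasoning

  Z₀ Z₁ : ∀ {t} → Bd t → ℚ
  ∏Z ∏Z₀ : ∀ {ts} → Bds ts → ℚ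
  Z₀ (leaf b)   = if b then 0ℚ else 1ℚ
  Z₀ (inner τs) = ∏Z τs
  Z₁ (leaf b)   = if b then lam else 0ℚ
  Z₁ (inner τs) = lam * ∏Z₀ τs
  ∏Z []         = 1ℚ
  ∏Z (τ ∷ τs)   = (Z₀ τ + Z₁ τ) * ∏Z τs
  ∏Z₀ []        = 1ℚ
  ∏Z₀ (τ ∷ τs)  = Z₀ τ * ∏Z₀ τs

  Z : ∀ {t} → Bd t → ℚ
  Z τ = Z₀ τ + Z₁ τ

  ∑-freeWeight  : ∀ t (τ : Bd t) → ∑ (freeWeight τ) (allConf t) ≡ Z₀ τ
  ∑-weight      : ∀ t (τ : Bd t) → ∑ (weight τ) (allConf t) ≡ Z τ
  ∑-freeWeights : ∀ ts (τs : Bds ts) → ∑ (freeWeights τs) (allConfs ts) ≡ ∏Z₀ τs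
  ∑-weights     : ∀ ts (τs : Bds ts) → ∑ (weights τs) (allConfs ts) ≡ ∏Z τs

  ∑-freeWeight _ (leaf true)  =
    solve 1 (λ l → con 0ℚ :* (con 1ℚ :* (l :* con 1ℚ)) :+ (con 1ℚ :* (con 0ℚ :* con 1ℚ) :+ con 0ℚ) := con 0ℚ) refl lam
  ∑-freeWeight _ (leaf false) =
    solve 1 (λ l → con 0ℚ :* (con 0ℚ :* (l :* con 1ℚ)) :+ (con 1ℚ :* (con 1ℚ :* con 1ℚ) :+ con 0ℚ) := con 1ℚ) refl lam
  ∑-freeWeight (node (t ∷ ts)) (inner τs) = begin
      ∑ (freeWeight (inner τs)) (allConf (node (t ∷ ts)))
    ≡⟨ ∑-allConf-node (t ∷ ts) (freeWeight (inner τs)) ⟩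
      ∑ (λ cs → 0ℚ * weight (inner τs) (true ◂ cs)) Cs + ∑ (λ cs → 1ℚ * weight (inner τs) (false ◂ cs)) Cs
    ≡⟨ cong₂ _+_ (∑-*ˡ 0ℚ (λ cs → weight (inner τs) (true ◂ cs)) Cs) (∑-*ˡ 1ℚ (λ cs → weight (inner τs) (false ◂ cs)) Cs) ⟩
      0ℚ * occupied + 1ℚ * free
    ≡⟨ solve 2 (λ x y → con 0ℚ :* x :+ con 1ℚ :* y := y) refl occupied free ⟩
      free
    ≡⟨ ∑-allConfs-cong (weight-root-free τs) ⟩
      ∑ (weights τs) Cs
    ≡⟨ ∑-weights (t ∷ ts) τs ⟩
      ∏Z τs ∎
    where
    open ≡-Reasoning
    Cs : List (Confs (t ∷ ts))
    Cs = allConfs (t ∷ ts)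
    occupied free : ℚ
    occupied = ∑ (λ cs → weight (inner τs) (true ◂ cs)) Cs
    free = ∑ (λ cs → weight (inner τs) (false ◂ cs)) Cs

  ∑-weight _ (leaf true)  =
    solve 1 (λ l → con 1ℚ :* (l :* con 1ℚ) :+ (con 0ℚ :* con 1ℚ :+ con 0ℚ) := con 0ℚ :+ l) refl lam
  ∑-weight _ (leaf false) =
    solve 1 (λ l → con 0ℚ :* (l :* con 1ℚ) :+ (con 1ℚ :* con 1ℚ :+ con 0ℚ) := con 1ℚ :+ con 0ℚ) refl lam
  ∑-weight (node (t ∷ ts)) (inner τs) = begin
      ∑ (weight (inner τs)) (allConf (node (t ∷ ts)))
    ≡⟨ ∑-allConf-node (t ∷ ts) (weight (inner τs)) ⟩
      ∑ (λ cs → weight (inner τs) (true ◂ cs)) Cs + ∑ (λ cs → weight (inner τs) (false ◂ cs)) Cs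
    ≡⟨ cong₂ _+_ (∑-allConfs-cong (weight-root-occupied τs)) (∑-allConfs-cong (weight-root-free τs)) ⟩
      ∑ (λ cs → lam * freeWeights τs cs) Cs + ∑ (weights τs) Cs
    ≡⟨ cong₂ _+_ (trans (∑-*ˡ lam (freeWeights τs) Cs) (cong (lam *_) (∑-freeWeights (t ∷ ts) τs))) (∑-weights (t ∷ ts) τs) ⟩
      lam * ∏Z₀ τs + ∏Z τs
    ≡⟨ ℚ.+-comm (lam * ∏Z₀ τs) (∏Z τs) ⟩
      Z (inner τs) ∎
    where
    open ≡-Reasoning
    Cs : List (Confs (t ∷ ts))
    Cs = allConfs (t ∷ ts)

  ∑-freeWeights [] [] = refl
  ∑-freeWeights (t ∷ ts) (τ ∷ τs) =
    trans (∑-product (freeWeight τ) (freeWeights τs) _∷_ (freeWeights (τ ∷ τs)) (freeWeights-∷ τ τs) (allConf t) (allConfs ts))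
          (cong₂ _*_ (∑-freeWeight t τ) (∑-freeWeights ts τs))

  ∑-weights [] [] = refl
  ∑-weights (t ∷ ts) (τ ∷ τs) =
    trans (∑-product (weight τ) (weights τs) _∷_ (weights (τ ∷ τs)) (weights-∷ τ τs) (allConf t) (allConfs ts))
          (cong₂ _*_ (∑-weight t τ) (∑-weights ts τs))

  weightSum≡∑ : ∀ t (τ : Bd t) P → weightSum lam t τ P ≡ ∑ (λ σ → ⟪ P σ ⟫ * weight τ σ) (allConf t)
  weightSum≡∑ t τ P = ∑-cong (λ σ → if-∧-then-else-0 (indep σ) (agree σ τ) (P σ) (lam ^ size σ)) (allConf t)

  pRoot≡Z₀⊘Z : ∀ t (τ : Bd t) → pRoot lam t τ ≡ Z₀ τ ⊘ Z τ
  pRoot≡Z₀⊘Z t τ = cong₂ _⊘_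
    (trans (weightSum≡∑ t τ (λ σ → not (occ σ))) (∑-freeWeight t τ))
    (trans (weightSum≡∑ t τ (λ _ → true)) (trans (∑-cong (λ σ → ℚ.*-identityˡ (weight τ σ)) (allConf t)) (∑-weight t τ)))

-- The tree recursion and interval bounds on T_{D_G}

children-nonEmpty : ∀ s → children s ≢ []
children-nonEmpty O  ()
children-nonEmpty N  ()
children-nonEmpty E  ()
children-nonEmpty W  ()
children-nonEmpty NN ()
children-nonEmpty NW ()
children-nonEmpty NE ()
children-nonEmpty WW ()
children-nonEmpty EE ()
children-nonEmpty WN ()
children-nonEmpty EN ()

module HardCore (lam : ℚ) (0<lam : 0ℚ < lam) where

  open PartitionFunction lam

  0≤lam : 0ℚ ≤ lam
  0≤lam = ℚ.<⇒≤ 0<lam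

  Z₀-nonNeg : ∀ {t} (τ : Bd t) → 0ℚ ≤ Z₀ τ
  Z₁-nonNeg : ∀ {t} (τ : Bd t) → 0ℚ ≤ Z₁ τ
  ∏Z-nonNeg : ∀ {ts} (τs : Bds ts) → 0ℚ ≤ ∏Z τs
  ∏Z₀-nonNeg : ∀ {ts} (τs : Bds ts) → 0ℚ ≤ ∏Z₀ τs
  Z₀-nonNeg (leaf true)  = ℚ.≤-refl
  Z₀-nonNeg (leaf false) = 0≤1
  Z₀-nonNeg (inner τs)   = ∏Z-nonNeg τs
  Z₁-nonNeg (leaf true)  = 0≤lam
  Z₁-nonNeg (leaf false) = ℚ.≤-refl
  Z₁-nonNeg (inner τs)   = 0≤* 0≤lam (∏Z₀-nonNeg τs)
  ∏Z-nonNeg []       = 0≤1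
  ∏Z-nonNeg (τ ∷ τs) = 0≤* (0≤+ (Z₀-nonNeg τ) (Z₁-nonNeg τ)) (∏Z-nonNeg τs)
  ∏Z₀-nonNeg []       = 0≤1
  ∏Z₀-nonNeg (τ ∷ τs) = 0≤* (Z₀-nonNeg τ) (∏Z₀-nonNeg τs)

  Z-pos : ∀ {t} (τ : Bd t) → 0ℚ < Z τ
  ∏Z-pos : ∀ {ts} (τs : Bds ts) → 0ℚ < ∏Z τs
  Z-pos (leaf true)  = ℚ.<-≤-trans 0<lam (ℚ.≤-reflexive (sym (ℚ.+-identityˡ lam)))
  Z-pos (leaf false) = 0<+ 0<1 ℚ.≤-refl
  Z-pos (inner τs)   = 0<+ (∏Z-pos τs) (Z₁-nonNeg (inner τs))
  ∏Z-pos []       = 0<1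
  ∏Z-pos (τ ∷ τs) = 0<* (Z-pos τ) (∏Z-pos τs)

  pRoot-nonNeg : ∀ t (τ : Bd t) → 0ℚ ≤ pRoot lam t τ
  pRoot-nonNeg t τ rewrite pRoot≡Z₀⊘Z t τ =
    *≤⇒≤⊘ (Z-pos τ) (ℚ.≤-trans (ℚ.≤-reflexive (ℚ.*-zeroˡ (Z τ))) (Z₀-nonNeg τ))

  pRoot≤1 : ∀ t (τ : Bd t) → pRoot lam t τ ≤ 1ℚ
  pRoot≤1 t τ rewrite pRoot≡Z₀⊘Z t τ =
    ≤*⇒⊘≤ (Z-pos τ) (ℚ.≤-trans (ℚ.≤-trans (ℚ.≤-reflexive (sym (ℚ.+-identityʳ (Z₀ τ)))) (ℚ.+-monoʳ-≤ (Z₀ τ) (Z₁-nonNeg τ)))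
                              (ℚ.≤-reflexive (sym (ℚ.*-identityˡ (Z τ)))))

  pRoots : ∀ {ts} → Bds ts → ℚ
  pRoots []                = 1ℚ
  pRoots (_∷_ {t} τ τs) = pRoot lam t τ * pRoots τs

  pRoots≡∏Z₀⊘∏Z : ∀ {ts} (τs : Bds ts) → pRoots τs ≡ ∏Z₀ τs ⊘ ∏Z τs
  pRoots≡∏Z₀⊘∏Z [] = refl
  pRoots≡∏Z₀⊘∏Z (_∷_ {t} τ τs) = begin
      pRoot lam t τ * pRoots τs
    ≡⟨ cong₂ _*_ (pRoot≡Z₀⊘Z t τ) (pRoots≡∏Z₀⊘∏Z τs) ⟩
      (Z₀ τ ⊘ Z τ) * (∏Z₀ τs ⊘ ∏Z τs)
    ≡⟨ ⊘-*-⊘ (Z₀ τ) (Z τ) (∏Z₀ τs) (∏Z τs) (Z-pos τ) (∏Z-pos τs) ⟩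
      ∏Z₀ (τ ∷ τs) ⊘ ∏Z (τ ∷ τs) ∎
    where open ≡-Reasoning

  pRoots-nonNeg : ∀ {ts} (τs : Bds ts) → 0ℚ ≤ pRoots τs
  pRoots-nonNeg []             = 0≤1
  pRoots-nonNeg (_∷_ {t} τ τs) = 0≤* (pRoot-nonNeg t τ) (pRoots-nonNeg τs)

  F : ℚ → ℚ
  F x = 1ℚ ⊘ (1ℚ + lam * x)

  1+lam*-pos : ∀ {x} → 0ℚ ≤ x → 0ℚ < 1ℚ + lam * x
  1+lam*-pos 0≤x = 0<+ 0<1 (0≤* 0≤lam 0≤x)

  pRoot-inner : ∀ {t ts} (τs : Bds (t ∷ ts)) → pRoot lam (node (t ∷ ts)) (inner τs) ≡ F (pRoots τs)
  pRoot-inner {t} {ts} τs = trans (pRoot≡Z₀⊘Z (node (t ∷ ts)) (inner τs)) (⊘-unique (Z-pos (inner τs)) (begin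
      F ρ * (∏Z τs + lam * ∏Z₀ τs)
    ≡⟨ cong (λ z → F ρ * (∏Z τs + lam * z)) (sym ρ*∏Z≡∏Z₀) ⟩
      F ρ * (∏Z τs + lam * (ρ * ∏Z τs))
    ≡⟨ solve 4 (λ f p l r → f :* (p :+ l :* (r :* p)) := f :* (con 1ℚ :+ l :* r) :* p) refl (F ρ) (∏Z τs) lam ρ ⟩
      F ρ * (1ℚ + lam * ρ) * ∏Z τs
    ≡⟨ cong (_* ∏Z τs) (⊘*-cancel 1ℚ (1+lam*-pos (pRoots-nonNeg τs))) ⟩
      1ℚ * ∏Z τs
    ≡⟨ ℚ.*-identityˡ (∏Z τs) ⟩
      ∏Z τs ∎))
    where
    open ≡-Reasoning
    ρ : ℚ
    ρ = pRoots τs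
    ρ*∏Z≡∏Z₀ : ρ * ∏Z τs ≡ ∏Z₀ τs
    ρ*∏Z≡∏Z₀ = trans (cong (_* ∏Z τs) (pRoots≡∏Z₀⊘∏Z τs)) (⊘*-cancel (∏Z₀ τs) (∏Z-pos τs))

  F-nonNeg : ∀ {x} → 0ℚ ≤ x → 0ℚ ≤ F x
  F-nonNeg {x} 0≤x = *≤⇒≤⊘ (1+lam*-pos 0≤x) (ℚ.≤-trans (ℚ.≤-reflexive (ℚ.*-zeroˡ (1ℚ + lam * x))) 0≤1)

  F-antitone : ∀ {x y} → 0ℚ ≤ x → x ≤ y → F y ≤ F x
  F-antitone {x} {y} 0≤x x≤y = *≤⇒≤⊘ (1+lam*-pos 0≤x) (begin
      F y * (1ℚ + lam * x) ≤⟨ *-monoˡ-≤ (F-nonNeg 0≤y) (ℚ.+-monoʳ-≤ 1ℚ (*-monoˡ-≤ 0≤lam x≤y)) ⟩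
      F y * (1ℚ + lam * y) ≡⟨ ⊘*-cancel 1ℚ (1+lam*-pos 0≤y) ⟩
      1ℚ                   ∎)
    where
    open ℚ.≤-Reasoning
    0≤y : 0ℚ ≤ y
    0≤y = ℚ.≤-trans 0≤x x≤y

  Bounds : ℕ → (State → ℚ) → (State → ℚ) → Set
  Bounds L lo hi = ∀ s (τ : Bd (build L s)) → lo s ≤ pRoot lam (build L s) τ × pRoot lam (build L s) τ ≤ hi s

  bounds-trivial : ∀ L → Bounds L (λ _ → 0ℚ) (λ _ → 1ℚ)
  bounds-trivial L s τ = pRoot-nonNeg (build L s) τ , pRoot≤1 (build L s) τ

  pRoots-bounds : ∀ {L lo hi} → (∀ s → 0ℚ ≤ lo s) → Bounds L lo hi →
                  ∀ cs (τs : Bds (map (build L) cs)) → ∏ lo cs ≤ pRoots τs × pRoots τs ≤ ∏ hi cs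
  pRoots-bounds 0≤lo bounds []       []       = ℚ.≤-refl , ℚ.≤-refl
  pRoots-bounds {L} {lo} {hi} 0≤lo bounds (c ∷ cs) (τ ∷ τs) =
    *-mono-≤ (0≤lo c) (∏-nonNeg lo 0≤lo cs) (proj₁ (bounds c τ)) (proj₁ rest) ,
    *-mono-≤ (pRoot-nonNeg (build L c) τ) (pRoots-nonNeg τs) (proj₂ (bounds c τ)) (proj₂ rest)
    where
    rest : ∏ lo cs ≤ pRoots τs × pRoots τs ≤ ∏ hi cs
    rest = pRoots-bounds 0≤lo bounds cs τs

  bounds-step : ∀ {L lo hi lo′ hi′} → (∀ s → 0ℚ ≤ lo s) → Bounds L lo hi →
                (∀ s → lo′ s ≤ F (∏ hi (children s))) → (∀ s → F (∏ lo (children s)) ≤ hi′ s) →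
                Bounds (suc L) lo′ hi′
  bounds-step {L} {lo} {hi} {lo′} {hi′} 0≤lo bounds lo′≤F F≤hi′ s τ
    with children s in children-s | lo′≤F s | F≤hi′ s
  ... | []     | _    | _    = ⊥-elim (children-nonEmpty s children-s)
  ... | c ∷ cs | lo′≤ | ≤hi′ with τ
  ...   | inner τs =
    ℚ.≤-trans lo′≤ (ℚ.≤-trans (F-antitone (pRoots-nonNeg τs) (proj₂ p-bounds)) (ℚ.≤-reflexive (sym (pRoot-inner τs)))) ,
    ℚ.≤-trans (ℚ.≤-reflexive (pRoot-inner τs)) (ℚ.≤-trans (F-antitone (∏-nonNeg lo 0≤lo (c ∷ cs)) (proj₁ p-bounds)) ≤hi′)
    where
    p-bounds : ∏ lo (c ∷ cs) ≤ pRoots τs × pRoots τs ≤ ∏ hi (c ∷ cs)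
    p-bounds = pRoots-bounds 0≤lo bounds (c ∷ cs) τs

  root-gap : ∀ {L lo hi} → Bounds L lo hi → (τ₁ τ₂ : Bd (TDG L)) →
             ∣ pRoot lam (TDG L) τ₁ - pRoot lam (TDG L) τ₂ ∣ ≤ hi O - lo O
  root-gap bounds τ₁ τ₂ = ∣-∣≤-width (proj₁ (bounds O τ₁)) (proj₂ (bounds O τ₁)) (proj₁ (bounds O τ₂)) (proj₂ (bounds O τ₂))

  F-difference : ∀ {x y} → 0ℚ ≤ x → 0ℚ ≤ y → F x - F y ≡ lam * (F x * F y) * (y - x)
  F-difference {x} {y} 0≤x 0≤y = begin
      F x - F y
    ≡⟨ solve 2 (λ a b → a :- b := a :* con 1ℚ :- b :* con 1ℚ) refl (F x) (F y) ⟩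
      F x * 1ℚ - F y * 1ℚ
    ≡⟨ cong₂ (λ u w → F x * u - F y * w) (sym (⊘*-cancel 1ℚ (1+lam*-pos 0≤y))) (sym (⊘*-cancel 1ℚ (1+lam*-pos 0≤x))) ⟩
      F x * (F y * (1ℚ + lam * y)) - F y * (F x * (1ℚ + lam * x))
    ≡⟨ solve 5 (λ a b l x y → a :* (b :* (con 1ℚ :+ l :* y)) :- b :* (a :* (con 1ℚ :+ l :* x)) := l :* (a :* b) :* (y :- x))
         refl (F x) (F y) lam x y ⟩
      lam * (F x * F y) * (y - x) ∎
    where open ≡-Reasoning

  -- A box [lB, hB] that the interval recursion maps into itself and on which it contracts by γ
  -- in the sup norm weighted by v.
  module Contraction (lB hB v : State → ℚ) (γ : ℚ) (0≤lB : ∀ s → 0ℚ ≤ lB s)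
    (lB-stable : ∀ s → lB s ≤ F (∏ hB (children s)))
    (hB-stable : ∀ s → F (∏ lB (children s)) ≤ hB s)
    (contracting : ∀ s → lam * (hB s * hB s) * ∂∏ hB v (children s) ≤ γ * v s) where

    record Enclosure (L : ℕ) (ε : ℚ) : Set where
      field
        lo hi : State → ℚ
        bounds : Bounds L lo hi
        lB≤lo  : ∀ s → lB s ≤ lo s
        lo≤hi  : ∀ s → lo s ≤ hi s
        hi≤hB  : ∀ s → hi s ≤ hB s
        width  : ∀ s → hi s - lo s ≤ ε * v s

    interval-recursion-contracts :
      ∀ {ε} (lo hi : State → ℚ) → 0ℚ ≤ ε → (∀ s → 0ℚ ≤ lo s) → (∀ s → lo s ≤ hi s) → (∀ s → hi s ≤ hB s) →
      (∀ s → hi s - lo s ≤ ε * v s) →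
      ∀ s → F (∏ lo (children s)) ≤ hB s → F (∏ lo (children s)) - F (∏ hi (children s)) ≤ γ * ε * v s
    interval-recursion-contracts {ε} lo hi 0≤ε 0≤lo lo≤hi hi≤hB width s F∏lo≤hB = begin
        F (∏ lo cs) - F (∏ hi cs)
      ≡⟨ F-difference 0≤∏lo 0≤∏hi ⟩
        lam * (F (∏ lo cs) * F (∏ hi cs)) * (∏ hi cs - ∏ lo cs)
      ≤⟨ *-monoʳ-≤ (0≤- ∏lo≤∏hi) (*-monoˡ-≤ 0≤lam (*-mono-≤ (F-nonNeg 0≤∏lo) (F-nonNeg 0≤∏hi) F∏lo≤hB
           (ℚ.≤-trans (F-antitone 0≤∏lo ∏lo≤∏hi) F∏lo≤hB))) ⟩
        κ * (∏ hi cs - ∏ lo cs)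
      ≤⟨ *-monoˡ-≤ 0≤κ (∏-difference≤∂∏ lo hi hB 0≤lo lo≤hi hi≤hB cs) ⟩
        κ * ∂∏ hB (λ c → hi c - lo c) cs
      ≤⟨ *-monoˡ-≤ 0≤κ (∂∏-mono-≤ hB (λ c → hi c - lo c) (λ c → ε * v c) 0≤hB width cs) ⟩
        κ * ∂∏ hB (λ c → ε * v c) cs
      ≡⟨ cong (κ *_) (∂∏-*ˡ hB v ε cs) ⟩
        κ * (ε * ∂∏ hB v cs)
      ≡⟨ solve 3 (λ k e d → k :* (e :* d) := e :* (k :* d)) refl κ ε (∂∏ hB v cs) ⟩
        ε * (κ * ∂∏ hB v cs)
      ≤⟨ *-monoˡ-≤ 0≤ε (contracting s) ⟩
        ε * (γ * v s)
      ≡⟨ solve 3 (λ e g x → e :* (g :* x) := g :* e :* x) refl ε γ (v s) ⟩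
        γ * ε * v s ∎
      where
      open ℚ.≤-Reasoning
      cs : List State
      cs = children s
      0≤hi : ∀ s → 0ℚ ≤ hi s
      0≤hi s = ℚ.≤-trans (0≤lo s) (lo≤hi s)
      0≤hB : ∀ s → 0ℚ ≤ hB s
      0≤hB s = ℚ.≤-trans (0≤hi s) (hi≤hB s)
      0≤∏lo : 0ℚ ≤ ∏ lo cs
      0≤∏lo = ∏-nonNeg lo 0≤lo cs
      0≤∏hi : 0ℚ ≤ ∏ hi cs
      0≤∏hi = ∏-nonNeg hi 0≤hi cs
      ∏lo≤∏hi : ∏ lo cs ≤ ∏ hi cs
      ∏lo≤∏hi = ∏-mono-≤ lo hi 0≤lo lo≤hi cs
      κ : ℚ
      κ = lam * (hB s * hB s)
      0≤κ : 0ℚ ≤ κ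
      0≤κ = 0≤* 0≤lam (0≤* (0≤hB s) (0≤hB s))

    enclosure-step : ∀ {L ε} → 0ℚ ≤ ε → Enclosure L ε → Enclosure (suc L) (γ * ε)
    enclosure-step {L} {ε} 0≤ε enc = record
      { lo     = lo′
      ; hi     = hi′
      ; bounds = bounds-step 0≤lo bounds (λ s → ℚ.≤-refl) (λ s → ℚ.≤-refl)
      ; lB≤lo  = λ s → ℚ.≤-trans (lB-stable s) (F-antitone (∏-nonNeg hi 0≤hi (children s)) (∏-mono-≤ hi hB 0≤hi hi≤hB (children s)))
      ; lo≤hi  = λ s → F-antitone (∏-nonNeg lo 0≤lo (children s)) (∏-mono-≤ lo hi 0≤lo lo≤hi (children s))
      ; hi≤hB  = hi′≤hB
      ; width  = λ s → interval-recursion-contracts lo hi 0≤ε 0≤lo lo≤hi hi≤hB width s (hi′≤hB s)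
      }
      where
      open Enclosure enc
      0≤lo : ∀ s → 0ℚ ≤ lo s
      0≤lo s = ℚ.≤-trans (0≤lB s) (lB≤lo s)
      0≤hi : ∀ s → 0ℚ ≤ hi s
      0≤hi s = ℚ.≤-trans (0≤lo s) (lo≤hi s)
      lo′ hi′ : State → ℚ
      lo′ s = F (∏ hi (children s))
      hi′ s = F (∏ lo (children s))
      hi′≤hB : ∀ s → hi′ s ≤ hB s
      hi′≤hB s = ℚ.≤-trans (F-antitone (∏-nonNeg lB 0≤lB (children s)) (∏-mono-≤ lB lo 0≤lB lB≤lo (children s))) (hB-stable s)

    enclosure-iterate : ∀ {L ε} → 0ℚ ≤ γ → 0ℚ ≤ ε → Enclosure L ε → ∀ j → Enclosure (j ℕ.+ L) (γ ^ j * ε)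
    enclosure-iterate {L} {ε} 0≤γ 0≤ε enc zero = subst (Enclosure L) (sym (ℚ.*-identityˡ ε)) enc
    enclosure-iterate {L} {ε} 0≤γ 0≤ε enc (suc j) =
      subst (Enclosure (suc j ℕ.+ L)) (sym (ℚ.*-assoc γ (γ ^ j) ε))
        (enclosure-step (0≤* (^-nonNeg 0≤γ j) 0≤ε) (enclosure-iterate 0≤γ 0≤ε enc j))

    enclosure-gap : ∀ {L ε} → Enclosure L ε → (τ₁ τ₂ : Bd (TDG L)) →
                    ∣ pRoot lam (TDG L) τ₁ - pRoot lam (TDG L) τ₂ ∣ ≤ ε * v O
    enclosure-gap enc τ₁ τ₂ = ℚ.≤-trans (root-gap bounds τ₁ τ₂) (width O)
      where open Enclosure enc

-- Fixed-point arithmetic for λ = 33/10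

activity-pos : 0ℚ < activity
activity-pos = ℚ.positive⁻¹ activity

open HardCore activity activity-pos

-- ι, D and δ are opaque so that the type checker never unfolds the numeral 2^40 symbolically;
-- only closed computations unfold them.
opaque
  ι : ℕ → ℚ
  ι n = fromℤ (ℤ.+ n)

  ι-+ : ∀ m n → ι (m ℕ.+ n) ≡ ι m + ι n
  ι-+ m n = ℚ.toℚᵘ-injective (ℚᵘ.≃-trans (ℚᵘ.*≡* (trans (cong (ℤ._* ℤ.1ℤ) (ℤ.pos-+ m n)) (lemma (ℤ.+ m) (ℤ.+ n))))
                                          (ℚᵘ.≃-sym (ℚ.toℚᵘ-homo-+ (ι m) (ι n))))
    where
    lemma : ∀ a b → (a ℤ.+ b) ℤ.* ℤ.1ℤ ≡ (a ℤ.* ℤ.1ℤ ℤ.+ b ℤ.* ℤ.1ℤ) ℤ.* ℤ.1ℤ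
    lemma = solve-∀

  ι-* : ∀ m n → ι (m ℕ.* n) ≡ ι m * ι n
  ι-* m n = ℚ.toℚᵘ-injective (ℚᵘ.≃-trans (ℚᵘ.*≡* (cong (ℤ._* ℤ.1ℤ) (ℤ.pos-* m n)))
                                          (ℚᵘ.≃-sym (ℚ.toℚᵘ-homo-* (ι m) (ι n))))

  ι-1 : ι 1 ≡ 1ℚ
  ι-1 = refl

  ι-mono : ∀ {m n} → m ℕ.≤ n → ι m ≤ ι n
  ι-mono m≤n = ℚ.toℚᵘ-cancel-≤ (ℚᵘ.*≤* (ℤ.*-monoʳ-≤-nonNeg ℤ.1ℤ (ℤ.+≤+ m≤n)))

  0≤ι : ∀ n → 0ℚ ≤ ι n
  0≤ι n = ι-mono ℕ.z≤n

opaque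
  D : ℕ
  D = 2 ℕ.^ 40

  δ : ℚ
  δ = ℤ.+ 1 / D

  0≤δ : 0ℚ ≤ δ
  0≤δ = ℚ.nonNegative⁻¹ δ

tenth : ℚ
tenth = ℤ.+ 1 / 10

γ : ℚ
γ = ℤ.+ 499 / 500

-- The fixed-point number n stands for n / D.
⟦_⟧ : ℕ → ℚ
⟦ n ⟧ = ι n * δ

opaque
  unfolding ι D δ

  ⟦0⟧ : ⟦ 0 ⟧ ≡ 0ℚ
  ⟦0⟧ = refl

  ⟦D⟧ : ⟦ D ⟧ ≡ 1ℚ
  ⟦D⟧ = refl

  ι10*tenth : ι 10 * tenth ≡ 1ℚ
  ι10*tenth = refl

  ι33*tenth : ι 33 * tenth ≡ activity
  ι33*tenth = refl

  γ*ι500 : γ * ι 500 ≡ ι 499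
  γ*ι500 = refl

  0<ι500 : 0ℚ < ι 500
  0<ι500 = ℚ.positive⁻¹ (ι 500)

⟦⟧-nonNeg : ∀ n → 0ℚ ≤ ⟦ n ⟧
⟦⟧-nonNeg n = 0≤* {ι n} {δ} (0≤ι n) 0≤δ

⟦⟧-mono : ∀ {m n} → m ℕ.≤ n → ⟦ m ⟧ ≤ ⟦ n ⟧
⟦⟧-mono {m} {n} m≤n = *-monoʳ-≤ {δ} {ι m} {ι n} 0≤δ (ι-mono m≤n)

⟦⟧-* : ∀ m n → ⟦ m ℕ.* n ⟧ ≡ ι m * ⟦ n ⟧
⟦⟧-* m n = trans (cong (_* δ) (ι-* m n)) (ℚ.*-assoc (ι m) (ι n) δ)

⟦⟧-+ : ∀ m n → ⟦ m ℕ.+ n ⟧ ≡ ⟦ m ⟧ + ⟦ n ⟧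
⟦⟧-+ m n = trans (cong (_* δ) (ι-+ m n)) (ℚ.*-distribʳ-+ δ (ι m) (ι n))

ι[D^k]*δ^k : ∀ k → ι (D ℕ.^ k) * δ ^ k ≡ 1ℚ
ι[D^k]*δ^k zero    = trans (cong (_* 1ℚ) ι-1) (ℚ.*-identityʳ 1ℚ)
ι[D^k]*δ^k (suc k) = begin
    ι (D ℕ.* D ℕ.^ k) * (δ * δ ^ k)
  ≡⟨ cong (_* (δ * δ ^ k)) (ι-* D (D ℕ.^ k)) ⟩
    ι D * ι (D ℕ.^ k) * (δ * δ ^ k)
  ≡⟨ solve 4 (λ a b d e → a :* b :* (d :* e) := (a :* d) :* (b :* e)) refl (ι D) (ι (D ℕ.^ k)) δ (δ ^ k) ⟩
    ⟦ D ⟧ * (ι (D ℕ.^ k) * δ ^ k)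
  ≡⟨ cong₂ _*_ ⟦D⟧ (ι[D^k]*δ^k k) ⟩
    1ℚ ∎
  where open ≡-Reasoning

∏⟦⟧ : ∀ (x : State → ℕ) cs → ∏ (⟦_⟧ ∘ x) cs ≡ ι (product (map x cs)) * δ ^ length cs
∏⟦⟧ x []       = sym (trans (cong (_* 1ℚ) ι-1) (ℚ.*-identityʳ 1ℚ))
∏⟦⟧ x (c ∷ cs) = begin
    ι (x c) * δ * ∏ (⟦_⟧ ∘ x) cs
  ≡⟨ cong (ι (x c) * δ *_) (∏⟦⟧ x cs) ⟩
    ι (x c) * δ * (ι (product (map x cs)) * δ ^ length cs)
  ≡⟨ solve 4 (λ a d p e → a :* d :* (p :* e) := a :* p :* (d :* e)) refl (ι (x c)) δ (ι (product (map x cs))) (δ ^ length cs) ⟩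
    ι (x c) * ι (product (map x cs)) * (δ * δ ^ length cs)
  ≡⟨ cong (_* (δ * δ ^ length cs)) (sym (ι-* (x c) (product (map x cs)))) ⟩
    ι (x c ℕ.* product (map x cs)) * (δ * δ ^ length cs) ∎
  where open ≡-Reasoning

-- a ⋅ scaledDen x cs ≤ scaledNum cs  iff  ⟦ a ⟧ (1 + λ ∏ ⟦ x c ⟧) ≤ 1: both sides are multiplied by
-- 10 D^(k+1) for k = length cs.
scaledNum : List State → ℕ
scaledNum cs = 10 ℕ.* D ℕ.^ length cs ℕ.* D

scaledDen : (State → ℕ) → List State → ℕ
scaledDen x cs = 10 ℕ.* D ℕ.^ length cs ℕ.+ 33 ℕ.* product (map x cs)

scale : List State → ℚ
scale cs = tenth * (δ * δ ^ length cs)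

0≤scale : ∀ cs → 0ℚ ≤ scale cs
0≤scale cs = 0≤* {tenth} (ℚ.nonNegative⁻¹ tenth) (0≤* {δ} 0≤δ (^-nonNeg 0≤δ (length cs)))

scaledNum-scale : ∀ cs → ι (scaledNum cs) * scale cs ≡ 1ℚ
scaledNum-scale cs = begin
    ι (10 ℕ.* D ℕ.^ k ℕ.* D) * (tenth * (δ * δ ^ k))
  ≡⟨ cong (_* (tenth * (δ * δ ^ k))) (trans (ι-* (10 ℕ.* D ℕ.^ k) D) (cong (_* ι D) (ι-* 10 (D ℕ.^ k)))) ⟩
    ι 10 * ι (D ℕ.^ k) * ι D * (tenth * (δ * δ ^ k))
  ≡⟨ solve 6 (λ a b c t d e → a :* b :* c :* (t :* (d :* e)) := (a :* t) :* (b :* e) :* (c :* d)) refl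
       (ι 10) (ι (D ℕ.^ k)) (ι D) tenth δ (δ ^ k) ⟩
    (ι 10 * tenth) * (ι (D ℕ.^ k) * δ ^ k) * ⟦ D ⟧
  ≡⟨ cong₂ (λ a b → a * b * ⟦ D ⟧) ι10*tenth (ι[D^k]*δ^k k) ⟩
    1ℚ * 1ℚ * ⟦ D ⟧
  ≡⟨ cong (1ℚ * 1ℚ *_) ⟦D⟧ ⟩
    1ℚ ∎
  where
  open ≡-Reasoning
  k : ℕ
  k = length cs

scaledDen-scale : ∀ a x cs → ι (a ℕ.* scaledDen x cs) * scale cs ≡ ⟦ a ⟧ * (1ℚ + activity * ∏ (⟦_⟧ ∘ x) cs)
scaledDen-scale a x cs = begin
    ι (a ℕ.* (10 ℕ.* D ℕ.^ k ℕ.+ 33 ℕ.* P)) * scale cs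
  ≡⟨ cong (_* scale cs) (trans (ι-* a _) (cong (ι a *_) (trans (ι-+ (10 ℕ.* D ℕ.^ k) (33 ℕ.* P))
                                                          (cong₂ _+_ (ι-* 10 (D ℕ.^ k)) (ι-* 33 P))))) ⟩
    ι a * (ι 10 * ι (D ℕ.^ k) + ι 33 * ι P) * (tenth * (δ * δ ^ k))
  ≡⟨ solve 8 (λ a t q h p e d f → a :* (t :* q :+ h :* p) :* (e :* (d :* f))
                                   := a :* d :* ((t :* e) :* (q :* f) :+ (h :* e) :* (p :* f))) refl
       (ι a) (ι 10) (ι (D ℕ.^ k)) (ι 33) (ι P) tenth δ (δ ^ k) ⟩
    ⟦ a ⟧ * ((ι 10 * tenth) * (ι (D ℕ.^ k) * δ ^ k) + (ι 33 * tenth) * (ι P * δ ^ k))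
  ≡⟨ cong₂ (λ u w → ⟦ a ⟧ * (u + w)) (cong₂ _*_ ι10*tenth (ι[D^k]*δ^k k)) (cong₂ _*_ ι33*tenth (sym (∏⟦⟧ x cs))) ⟩
    ⟦ a ⟧ * (1ℚ * 1ℚ + activity * ∏ (⟦_⟧ ∘ x) cs) ∎
  where
  open ≡-Reasoning
  k P : ℕ
  k = length cs
  P = product (map x cs)

lower-sound : ∀ a x cs → T (a ℕ.* scaledDen x cs ℕ.≤ᵇ scaledNum cs) → ⟦ a ⟧ ≤ F (∏ (⟦_⟧ ∘ x) cs)
lower-sound a x cs check = *≤⇒≤⊘ (1+lam*-pos (∏-nonNeg (⟦_⟧ ∘ x) (⟦⟧-nonNeg ∘ x) cs)) (begin
    ⟦ a ⟧ * (1ℚ + activity * ∏ (⟦_⟧ ∘ x) cs)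
  ≡⟨ sym (scaledDen-scale a x cs) ⟩
    ι (a ℕ.* scaledDen x cs) * scale cs
  ≤⟨ *-monoʳ-≤ (0≤scale cs) (ι-mono (ℕ.≤ᵇ⇒≤ (a ℕ.* scaledDen x cs) (scaledNum cs) check)) ⟩
    ι (scaledNum cs) * scale cs
  ≡⟨ scaledNum-scale cs ⟩
    1ℚ ∎)
  where open ℚ.≤-Reasoning

upper-sound : ∀ b x cs → T (scaledNum cs ℕ.≤ᵇ b ℕ.* scaledDen x cs) → F (∏ (⟦_⟧ ∘ x) cs) ≤ ⟦ b ⟧
upper-sound b x cs check = ≤*⇒⊘≤ (1+lam*-pos (∏-nonNeg (⟦_⟧ ∘ x) (⟦⟧-nonNeg ∘ x) cs)) (begin
    1ℚ
  ≡⟨ sym (scaledNum-scale cs) ⟩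
    ι (scaledNum cs) * scale cs
  ≤⟨ *-monoʳ-≤ (0≤scale cs) (ι-mono (ℕ.≤ᵇ⇒≤ (scaledNum cs) (b ℕ.* scaledDen x cs) check)) ⟩
    ι (b ℕ.* scaledDen x cs) * scale cs
  ≡⟨ scaledDen-scale b x cs ⟩
    ⟦ b ⟧ * (1ℚ + activity * ∏ (⟦_⟧ ∘ x) cs) ∎)
  where open ℚ.≤-Reasoning

-- Certified interval iteration

allStates : List State
allStates = O ∷ N ∷ E ∷ W ∷ NN ∷ NW ∷ NE ∷ WW ∷ EE ∷ WN ∷ EN ∷ []

∈-allStates : ∀ s → s ∈ allStates
∈-allStates O  = here refl
∈-allStates N  = there (here refl)
∈-allStates E  = there (there (here refl))
∈-allStates W  = there (there (there (here refl)))
∈-allStates NN = there (there (there (there (here refl))))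
∈-allStates NW = there (there (there (there (there (here refl)))))
∈-allStates NE = there (there (there (there (there (there (here refl))))))
∈-allStates WW = there (there (there (there (there (there (there (here refl)))))))
∈-allStates EE = there (there (there (there (there (there (there (there (here refl))))))))
∈-allStates WN = there (there (there (there (there (there (there (there (there (here refl)))))))))
∈-allStates EN = there (there (there (there (there (there (there (there (there (there (here refl))))))))))

everyState : (State → Bool) → Bool
everyState P = all P allStates

everyState-sound : ∀ P → T (everyState P) → ∀ s → T (P s)
everyState-sound P h s = lookup (all⁺ P allStates h) (∈-allStates s)

record Interval : Set where
  constructor ⟨_,_⟩
  field
    lower upper : ℕ

open Interval

data Table : Set where
  table : (o n e w nn nw ne ww ee wn en : Interval) → Table

_!_ : Table → State → Interval
table o _ _ _ _  _  _  _  _  _  _  ! O  = o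
table _ n _ _ _  _  _  _  _  _  _  ! N  = n
table _ _ e _ _  _  _  _  _  _  _  ! E  = e
table _ _ _ w _  _  _  _  _  _  _  ! W  = w
table _ _ _ _ nn _  _  _  _  _  _  ! NN = nn
table _ _ _ _ _  nw _  _  _  _  _  ! NW = nw
table _ _ _ _ _  _  ne _  _  _  _  ! NE = ne
table _ _ _ _ _  _  _  ww _  _  _  ! WW = ww
table _ _ _ _ _  _  _  _  ee _  _  ! EE = ee
table _ _ _ _ _  _  _  _  _  wn _  ! WN = wn
table _ _ _ _ _  _  _  _  _  _  en ! EN = en

tabulate : (State → Interval) → Table
tabulate f = table (f O) (f N) (f E) (f W) (f NN) (f NW) (f NE) (f WW) (f EE) (f WN) (f EN)

lo hi : Table → State → ℚ
lo t s = ⟦ lower (t ! s) ⟧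
hi t s = ⟦ upper (t ! s) ⟧

split-∧ : ∀ a b → T (a ∧ b) → T a × T b
split-∧ a b = to (T-∧ {a} {b})

refines : Table → Table → State → Bool
refines t t′ s = (lower (t′ ! s) ℕ.* scaledDen (upper ∘ (t !_)) (children s) ℕ.≤ᵇ scaledNum (children s))
               ∧ (scaledNum (children s) ℕ.≤ᵇ upper (t′ ! s) ℕ.* scaledDen (lower ∘ (t !_)) (children s))

refines-sound : ∀ t t′ → T (everyState (refines t t′)) →
                ∀ s → lo t′ s ≤ F (∏ (hi t) (children s)) × F (∏ (lo t) (children s)) ≤ hi t′ s
refines-sound t t′ check s =
  lower-sound (lower (t′ ! s)) (upper ∘ (t !_)) (children s) (proj₁ checked) ,
  upper-sound (upper (t′ ! s)) (lower ∘ (t !_)) (children s) (proj₂ checked)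
  where
  checked : T (lower (t′ ! s) ℕ.* scaledDen (upper ∘ (t !_)) (children s) ℕ.≤ᵇ scaledNum (children s))
          × T (scaledNum (children s) ℕ.≤ᵇ upper (t′ ! s) ℕ.* scaledDen (lower ∘ (t !_)) (children s))
  checked = split-∧ (lower (t′ ! s) ℕ.* scaledDen (upper ∘ (t !_)) (children s) ℕ.≤ᵇ scaledNum (children s))
                    (scaledNum (children s) ℕ.≤ᵇ upper (t′ ! s) ℕ.* scaledDen (lower ∘ (t !_)) (children s))
                    (everyState-sound (refines t t′) check s)

-- The tolerance g bounds D times the width of the root interval and shrinks by the factor γ.
record Stage : Set where
  constructor _,_
  field
    box       : Table
    tolerance : ℕ

open Stage

-- Rounding only proposes the next box; its validity is checked by refines.
_div_ : ℕ → ℕ → ℕ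
m div n = m ℕ./ suc (n ℕ.∸ 1)

refine : Table → Table
refine t = tabulate λ s →
  ⟨ scaledNum (children s) div scaledDen (upper ∘ (t !_)) (children s)
  , suc (scaledNum (children s) div scaledDen (lower ∘ (t !_)) (children s)) ⟩

next : Stage → Stage
next (t , g) = refine t , 499 ℕ.* g ℕ./ 500

iterate : ℕ → Stage → Stage
iterate zero    p = p
iterate (suc i) p = iterate i (next p)

containsUnit : Table → State → Bool
containsUnit t s = (lower (t ! s) ℕ.≤ᵇ 0) ∧ (D ℕ.≤ᵇ upper (t ! s))

validStart : Stage → Bool
validStart (t , g) = everyState (containsUnit t) ∧ (g ℕ.≤ᵇ D)

validStep : Stage → Stage → Bool
validStep (t , g) (t′ , g′) = everyState (refines t t′) ∧ (500 ℕ.* g′ ℕ.≤ᵇ 499 ℕ.* g)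

narrow : Stage → Bool
narrow (t , g) = upper (t ! O) ℕ.≤ᵇ lower (t ! O) ℕ.+ g

Gap : ℕ → Set
Gap L = (τ₁ τ₂ : Bd (TDG L)) → ∣ pRoot activity (TDG L) τ₁ - pRoot activity (TDG L) τ₂ ∣ ≤ γ ^ L

record Sound (L : ℕ) (p : Stage) : Set where
  field
    bounds       : Bounds L (lo (box p)) (hi (box p))
    tolerance≤γ^ : ⟦ tolerance p ⟧ ≤ γ ^ L

sound-start : ∀ p → T (validStart p) → Sound 0 p
sound-start (t , g) check = record
  { bounds       = λ s τ → ℚ.≤-trans (lo≤0 s) (proj₁ (bounds-trivial 0 s τ))
                         , ℚ.≤-trans (proj₂ (bounds-trivial 0 s τ)) (1≤hi s)
  ; tolerance≤γ^ = ℚ.≤-trans (⟦⟧-mono (ℕ.≤ᵇ⇒≤ g D (proj₂ checks))) (ℚ.≤-reflexive ⟦D⟧)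
  }
  where
  checks : T (everyState (containsUnit t)) × T (g ℕ.≤ᵇ D)
  checks = split-∧ (everyState (containsUnit t)) (g ℕ.≤ᵇ D) check
  contains : ∀ s → T (lower (t ! s) ℕ.≤ᵇ 0) × T (D ℕ.≤ᵇ upper (t ! s))
  contains s = split-∧ (lower (t ! s) ℕ.≤ᵇ 0) (D ℕ.≤ᵇ upper (t ! s)) (everyState-sound (containsUnit t) (proj₁ checks) s)
  lo≤0 : ∀ s → lo t s ≤ 0ℚ
  lo≤0 s = ℚ.≤-trans (⟦⟧-mono (ℕ.≤ᵇ⇒≤ (lower (t ! s)) 0 (proj₁ (contains s)))) (ℚ.≤-reflexive ⟦0⟧)
  1≤hi : ∀ s → 1ℚ ≤ hi t s
  1≤hi s = ℚ.≤-trans (ℚ.≤-reflexive (sym ⟦D⟧)) (⟦⟧-mono (ℕ.≤ᵇ⇒≤ D (upper (t ! s)) (proj₂ (contains s))))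

tolerance-step : ∀ g g′ → T (500 ℕ.* g′ ℕ.≤ᵇ 499 ℕ.* g) → ⟦ g′ ⟧ ≤ γ * ⟦ g ⟧
tolerance-step g g′ check = *-cancelʳ-≤ 0<ι500 (begin
    ⟦ g′ ⟧ * ι 500
  ≡⟨ trans (ℚ.*-comm ⟦ g′ ⟧ (ι 500)) (sym (⟦⟧-* 500 g′)) ⟩
    ⟦ 500 ℕ.* g′ ⟧
  ≤⟨ ⟦⟧-mono (ℕ.≤ᵇ⇒≤ (500 ℕ.* g′) (499 ℕ.* g) check) ⟩
    ⟦ 499 ℕ.* g ⟧
  ≡⟨ ⟦⟧-* 499 g ⟩
    ι 499 * ⟦ g ⟧
  ≡⟨ cong (_* ⟦ g ⟧) (sym γ*ι500) ⟩
    γ * ι 500 * ⟦ g ⟧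
  ≡⟨ solve 3 (λ c i x → c :* i :* x := c :* x :* i) refl γ (ι 500) ⟦ g ⟧ ⟩
    γ * ⟦ g ⟧ * ι 500 ∎)
  where open ℚ.≤-Reasoning

sound-step : ∀ {L} p p′ → T (validStep p p′) → Sound L p → Sound (suc L) p′
sound-step {L} (t , g) (t′ , g′) check sound = record
  { bounds       = bounds-step (λ s → ⟦⟧-nonNeg (lower (t ! s))) bounds
                     (proj₁ ∘ refines-sound t t′ (proj₁ checks)) (proj₂ ∘ refines-sound t t′ (proj₁ checks))
  ; tolerance≤γ^ = ℚ.≤-trans (tolerance-step g g′ (proj₂ checks)) (*-monoˡ-≤ (ℚ.nonNegative⁻¹ γ) tolerance≤γ^)
  }
  where
  open Sound sound
  checks : T (everyState (refines t t′)) × T (500 ℕ.* g′ ℕ.≤ᵇ 499 ℕ.* g)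
  checks = split-∧ (everyState (refines t t′)) (500 ℕ.* g′ ℕ.≤ᵇ 499 ℕ.* g) check

sound-gap : ∀ {L} p → T (narrow p) → Sound L p → Gap L
sound-gap (t , g) check sound τ₁ τ₂ = ℚ.≤-trans (root-gap bounds τ₁ τ₂) (ℚ.≤-trans width tolerance≤γ^)
  where
  open Sound sound
  width : hi t O - lo t O ≤ ⟦ g ⟧
  width = p≤q+r⇒p-q≤r (ℚ.≤-trans (⟦⟧-mono (ℕ.≤ᵇ⇒≤ (upper (t ! O)) (lower (t ! O) ℕ.+ g) check)) (ℚ.≤-reflexive (⟦⟧-+ (lower (t ! O)) g)))

-- The weights v, the width ε₀ and the depth K were found numerically.
ε₀ : ℚ
ε₀ = ℤ.+ 1 / 1000

v : State → ℚ
v O  = ℤ.+ 1000001 / 1000000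
v N  = ℤ.+ 1000001 / 1000000
v NN = ℤ.+ 1000001 / 1000000
v E  = ℤ.+ 713801 / 1000000
v W  = ℤ.+ 713801 / 1000000
v NW = ℤ.+ 713801 / 1000000
v NE = ℤ.+ 713801 / 1000000
v WW = ℤ.+ 713801 / 1000000
v EE = ℤ.+ 713801 / 1000000
v WN = ℤ.+ 731283 / 1000000
v EN = ℤ.+ 731283 / 1000000

contracts : Table → State → Bool
contracts t s = (lo t s ℚ.≤ᵇ hi t s)
              ∧ ((hi t s - lo t s ℚ.≤ᵇ ε₀ * v s)
              ∧ (activity * (hi t s * hi t s) * ∂∏ (hi t) v (children s) ℚ.≤ᵇ γ * v s))

≤ᵇ⇒≤ : ∀ p q → T (p ℚ.≤ᵇ q) → p ≤ q
≤ᵇ⇒≤ p q = ℚ.≤ᵇ⇒≤ {p} {q}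

contracts-sound : ∀ t s → T (contracts t s) →
                  lo t s ≤ hi t s × hi t s - lo t s ≤ ε₀ * v s ×
                  activity * (hi t s * hi t s) * ∂∏ (hi t) v (children s) ≤ γ * v s
contracts-sound t s check = ≤ᵇ⇒≤ (lo t s) (hi t s) (proj₁ checks)
                          , ≤ᵇ⇒≤ (hi t s - lo t s) (ε₀ * v s) (proj₁ checks′)
                          , ≤ᵇ⇒≤ (activity * (hi t s * hi t s) * ∂∏ (hi t) v (children s)) (γ * v s) (proj₂ checks′)
  where
  checks : T (lo t s ℚ.≤ᵇ hi t s)
         × T ((hi t s - lo t s ℚ.≤ᵇ ε₀ * v s) ∧ (activity * (hi t s * hi t s) * ∂∏ (hi t) v (children s) ℚ.≤ᵇ γ * v s))
  checks = split-∧ (lo t s ℚ.≤ᵇ hi t s)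
                   ((hi t s - lo t s ℚ.≤ᵇ ε₀ * v s) ∧ (activity * (hi t s * hi t s) * ∂∏ (hi t) v (children s) ℚ.≤ᵇ γ * v s))
                   check
  checks′ : T (hi t s - lo t s ℚ.≤ᵇ ε₀ * v s) × T (activity * (hi t s * hi t s) * ∂∏ (hi t) v (children s) ℚ.≤ᵇ γ * v s)
  checks′ = split-∧ (hi t s - lo t s ℚ.≤ᵇ ε₀ * v s) (activity * (hi t s * hi t s) * ∂∏ (hi t) v (children s) ℚ.≤ᵇ γ * v s)
                    (proj₂ checks)

contractive : Stage → Bool
contractive (t , g) = everyState (refines t t) ∧ (everyState (contracts t) ∧ (ε₀ * v O ℚ.≤ᵇ ⟦ g ⟧))

certify : ℕ → Stage → Bool
certify zero    p = narrow p ∧ contractive p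
certify (suc k) p = narrow p ∧ (validStep p (next p) ∧ certify k (next p))

certify-suc : ∀ k p → T (certify (suc k) p) → T (narrow p) × T (validStep p (next p)) × T (certify k (next p))
certify-suc k p c = proj₁ checks , split-∧ (validStep p (next p)) (certify k (next p)) (proj₂ checks)
  where
  checks : T (narrow p) × T (validStep p (next p) ∧ certify k (next p))
  checks = split-∧ (narrow p) (validStep p (next p) ∧ certify k (next p)) c

certify-narrow : ∀ k p → T (certify k p) → ∀ i → i ℕ.≤ k → T (narrow (iterate i p))
certify-narrow zero    p c zero    _           = proj₁ (split-∧ (narrow p) (contractive p) c)
certify-narrow (suc k) p c zero    _           = proj₁ (certify-suc k p c)
certify-narrow (suc k) p c (suc i) (ℕ.s≤s i≤k) = certify-narrow k (next p) (proj₂ (proj₂ (certify-suc k p c))) i i≤k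

certify-step : ∀ k p → T (certify k p) → ∀ i → i ℕ.< k → T (validStep (iterate i p) (iterate (suc i) p))
certify-step (suc k) p c zero    _           = proj₁ (proj₂ (certify-suc k p c))
certify-step (suc k) p c (suc i) (ℕ.s≤s i<k) = certify-step k (next p) (proj₂ (proj₂ (certify-suc k p c))) i i<k

certify-final : ∀ k p → T (certify k p) → T (contractive (iterate k p))
certify-final zero    p c = proj₂ (split-∧ (narrow p) (contractive p) c)
certify-final (suc k) p c = certify-final k (next p) (proj₂ (proj₂ (certify-suc k p c)))

K : ℕ
K = 1200

start : Stage
start = tabulate (λ _ → ⟨ 0 , D ⟩) , D

-- As an equation with true, the certificate is evaluated once, by refl.
opaque
  unfolding ι D δ

  certificate : validStart start ∧ certify K start ≡ true
  certificate = refl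

certified : T (validStart start) × T (certify K start)
certified = split-∧ (validStart start) (certify K start) (from T-≡ certificate)

sound : ∀ L → L ℕ.≤ K → Sound L (iterate L start)
sound zero    _   = sound-start start (proj₁ certified)
sound (suc L) L<K = sound-step (iterate L start) (iterate (suc L) start)
                      (certify-step K start (proj₂ certified) L L<K) (sound L (ℕ.<⇒≤ L<K))

gap-early : ∀ L → L ℕ.≤ K → Gap L
gap-early L L≤K = sound-gap (iterate L start) (certify-narrow K start (proj₂ certified) L L≤K) (sound L L≤K)

contractive-gap : ∀ {L} p → Sound L p → T (contractive p) → ∀ j → Gap (j ℕ.+ L)
contractive-gap {L} (t , g) sound check j τ₁ τ₂ = begin
    ∣ pRoot activity (TDG (j ℕ.+ L)) τ₁ - pRoot activity (TDG (j ℕ.+ L)) τ₂ ∣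
  ≤⟨ enclosure-gap (enclosure-iterate 0≤γ (ℚ.nonNegative⁻¹ ε₀) enclosure j) τ₁ τ₂ ⟩
    γ ^ j * ε₀ * v O
  ≡⟨ ℚ.*-assoc (γ ^ j) ε₀ (v O) ⟩
    γ ^ j * (ε₀ * v O)
  ≤⟨ *-monoˡ-≤ (^-nonNeg 0≤γ j) (ℚ.≤-trans (≤ᵇ⇒≤ (ε₀ * v O) ⟦ g ⟧ (proj₂ checks′)) tolerance≤γ^) ⟩
    γ ^ j * γ ^ L
  ≡⟨ sym (^-+ γ j L) ⟩
    γ ^ (j ℕ.+ L) ∎
  where
  open ℚ.≤-Reasoning
  open Sound sound
  0≤γ : 0ℚ ≤ γ
  0≤γ = ℚ.nonNegative⁻¹ γ
  checks : T (everyState (refines t t)) × T (everyState (contracts t) ∧ (ε₀ * v O ℚ.≤ᵇ ⟦ g ⟧))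
  checks = split-∧ (everyState (refines t t)) (everyState (contracts t) ∧ (ε₀ * v O ℚ.≤ᵇ ⟦ g ⟧)) check
  checks′ : T (everyState (contracts t)) × T (ε₀ * v O ℚ.≤ᵇ ⟦ g ⟧)
  checks′ = split-∧ (everyState (contracts t)) (ε₀ * v O ℚ.≤ᵇ ⟦ g ⟧) (proj₂ checks)
  contracting : ∀ s → lo t s ≤ hi t s × hi t s - lo t s ≤ ε₀ * v s ×
                      activity * (hi t s * hi t s) * ∂∏ (hi t) v (children s) ≤ γ * v s
  contracting s = contracts-sound t s (everyState-sound (contracts t) (proj₁ checks′) s)
  open Contraction (lo t) (hi t) v γ (λ s → ⟦⟧-nonNeg (lower (t ! s)))
    (λ s → proj₁ (refines-sound t t (proj₁ checks) s)) (λ s → proj₂ (refines-sound t t (proj₁ checks) s))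
    (λ s → proj₂ (proj₂ (contracting s)))
  enclosure : Enclosure L ε₀
  enclosure = record
    { lo = lo t ; hi = hi t ; bounds = bounds
    ; lB≤lo = λ s → ℚ.≤-refl
    ; lo≤hi = λ s → proj₁ (contracting s)
    ; hi≤hB = λ s → ℚ.≤-refl
    ; width = λ s → proj₁ (proj₂ (contracting s))
    }

lemma7 : WSM-TDG activity
lemma7 = γ , ℚ.positive⁻¹ γ , toWitness {a? = γ ℚ.<? 1ℚ} tt , gap
  where
  gap : ∀ L → Gap L
  gap L with L ℕ.≤? K
  ... | yes L≤K = gap-early L L≤K
  ... | no  L≰K = subst Gap (ℕ.m∸n+n≡m (ℕ.≰⇒≥ L≰K))
                    (contractive-gap (iterate K start) (sound K ℕ.≤-refl) (certify-final K start (proj₂ certified)) (L ℕ.∸ K))
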